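{- Let $\mathcal C,\mathcal D$ be finite stable configuration structures. Then $\mathcal C$ and $\mathcal D$ are hereditary history-preserving (HH) bisimilar if and only if the defender $D$ has a winning strategy for the game $G(\mathcal C,\mathcal D)$.
   Context: A configuration structure over $\mathsf{Act}$ is $\mathcal C=(C,\ell)$, $C$ a family of finite sets (configurations), $\ell:\bigcup_{X\in C}X\to\mathsf{Act}$, events $E_{\mathcal C}=\bigcup C$; finite means $C$ is finite. Stable: $\emptyset\in C$; every nonempty $X\in C$ has $e\in X$ with $X\setminus\{e\}\in C$; for $X,Y,Z\in C$ with $X\cup Y\subseteq Z$, $X\cup Y\in C$ and $X\cap Y\in C$. For $X\in C$: $d\le_Xe$ iff every $Y\in C$ with $Y\subseteq X$, $e\in Y$ contains $d$; $d<_Xe$ iff $d\le_Xe$, $d\ne e$. $X\xrightarrow{e}X'$ iff $X,X'\in C$, $X\subseteq X'$, $X'\setminus X=\{e\}$; $X\xrightarrow{a}X'$ iff this holds for some $e$ with $\ell(e)=a$. $f:X\cong Y$ means $f$ is a label-preserving bijection with $d<_Xe\iff f(d)<_Yf(e)$. HH bisimulation: $\mathcal R\subseteq C_{\mathcal C}\times C_{\mathcal D}\times\mathcal P(E_{\mathcal C}\times E_{\mathcal D})$ with $\mathcal R(\emptyset,\emptyset,\emptyset)$ such that whenever $\mathcal R(X,Y,f)$, $a\in\mathsf{Act}$: $f:X\cong Y$; if $X\xrightarrow{a}X'$ then $\exists Y',f'$ with $Y\xrightarrow{a}Y'$, $\mathcal R(X',Y',f')$, $f'\restriction X=f$, and symmetrically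 for $Y\xrightarrow{a}Y'$; if $X'\xrightarrow{a}X$ then $\exists Y',f'$ with $Y'\xrightarrow{a}Y$, $\mathcal R(X',Y',f')$, $f\restriction X'=f'$, and symmetrically for $Y'\xrightarrow{a}Y$. The game $G(\mathcal C,\mathcal D)$: players $A$ (attacker) and $D$ (defender); states are triples $(X,Y,f)$ with $X\in C_{\mathcal C}$, $Y\in C_{\mathcal D}$, $f:X\cong Y$; start state $(\emptyset,\emptyset,\emptyset)$. In each round, $A$ chooses a forward move $X\xrightarrow{e}X'$ or reverse move $X'\xrightarrow{e}X$ of $\mathcal C$, or a forward or reverse move of $\mathcal D$ from $Y$; $D$ must reply with a move of the other structure in the same direction with an event of the same label, such that, with $f'=f\cup\{(e,e')\}$ (forward) or $f'=f$ restricted to the new configuration of $\mathcal C$ (reverse), where $e,e'$ are the moved events of $\mathcal C,\mathcal D$, the resulting triple $(X',Y',f')$ is a state (i.e. $f'$ is an isomorphism). $D$ wins if a previously visited state is reached; $A$ wins if $D$ cannot reply; $D$ also wins if $A$ cannot choose any move. -}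

module Defs where

open import Data.Nat using (ℕ)
open import Data.Fin using (Fin)
open import Data.Fin.Subset
  using (Subset; _∈_; _∉_; _⊆_; _∪_; _∩_; ⁅_⁆; Nonempty; _-_)
  renaming (⊥ to ∅)
open import Data.Bool using (Bool; T; if_then_else_)
open import Data.Vec using (Vec; lookup; updateAt; replicate; tabulate)
open import Data.Product using (Σ; ∃; ∃-syntax; _×_; _,_)
open import Data.List using (List; []; _∷_)
import Data.List.Membership.Propositional as ListMem
open import Relation.Binary.PropositionalEquality using (_≡_; _≢_)
open import Relation.Nullary using (¬_)
open import Function.Bundles using (_⇔_)

-- Events are (w.l.o.g., since a finite configuration structure has
-- finitely many events) the elements of Fin n; a configuration is a
-- subset of the events; the family C of configurations is a finite
-- family, given by its (Boolean) membership test.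

record ConfStr (Act : Set) : Set where
  field
    n      : ℕ
    isConf : Subset n → Bool
    ℓ      : Fin n → Act
    covers : ∀ (e : Fin n) → ∃[ X ] (T (isConf X) × e ∈ X)

  Event : Set
  Event = Fin n

  Conf : Subset n → Set
  Conf X = T (isConf X)

  _≤[_]_ : Event → Subset n → Event → Set
  d ≤[ X ] e = ∀ (Y : Subset n) → Conf Y → Y ⊆ X → e ∈ Y → d ∈ Y

  _<[_]_ : Event → Subset n → Event → Set
  d <[ X ] e = (d ≤[ X ] e) × (d ≢ e)

  Step : Subset n → Event → Subset n → Set
  Step X e X' =
    Conf X × Conf X' × X ⊆ X' × e ∈ X' × e ∉ X ×
    (∀ (d : Event) → d ∈ X' → d ∉ X → d ≡ e)

  StepL : Subset n → Act → Subset n → Set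
  StepL X a X' = ∃[ e ] (ℓ e ≡ a × Step X e X')

open ConfStr

record Stable {Act : Set} (𝒞 : ConfStr Act) : Set where
  field
    empty   : Conf 𝒞 ∅
    coinit  : ∀ X → Conf 𝒞 X → Nonempty X →
              ∃[ e ] (e ∈ X × Conf 𝒞 (X - e))
    closed  : ∀ X Y Z → Conf 𝒞 X → Conf 𝒞 Y → Conf 𝒞 Z → (X ∪ Y) ⊆ Z →
              Conf 𝒞 (X ∪ Y) × Conf 𝒞 (X ∩ Y)

-- Relations between events: a subset of Fin n × Fin m, represented as a
-- vector of rows (row d = the set of e related to d).

Rel : ℕ → ℕ → Set
Rel n m = Vec (Subset m) n

_∋⟨_,_⟩ : ∀ {n m} → Rel n m → Fin n → Fin m → Set
f ∋⟨ d , e ⟩ = e ∈ lookup f d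

emptyRel : ∀ {n m} → Rel n m
emptyRel = replicate _ ∅

addPair : ∀ {n m} → Rel n m → Fin n → Fin m → Rel n m
addPair f d e = updateAt f d (λ row → row ∪ ⁅ e ⁆)

restrict : ∀ {n m} → Rel n m → Subset n → Rel n m
restrict f X = tabulate (λ d → if lookup X d then lookup f d else ∅)

module _ {Act : Set} (𝒞 𝒟 : ConfStr Act) where

  private
    module C = ConfStr 𝒞
    module D = ConfStr 𝒟

  record Iso (X : Subset C.n) (Y : Subset D.n) (f : Rel C.n D.n) : Set where
    field
      dom⊆     : ∀ d e → f ∋⟨ d , e ⟩ → d ∈ X
      cod⊆     : ∀ d e → f ∋⟨ d , e ⟩ → e ∈ Y
      total    : ∀ d → d ∈ X → ∃[ e ] (f ∋⟨ d , e ⟩)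
      onto     : ∀ e → e ∈ Y → ∃[ d ] (f ∋⟨ d , e ⟩)
      func     : ∀ d e e' → f ∋⟨ d , e ⟩ → f ∋⟨ d , e' ⟩ → e ≡ e'
      inj      : ∀ d d' e → f ∋⟨ d , e ⟩ → f ∋⟨ d' , e ⟩ → d ≡ d'
      label    : ∀ d e → f ∋⟨ d , e ⟩ → C.ℓ d ≡ D.ℓ e
      order    : ∀ d₁ e₁ d₂ e₂ → f ∋⟨ d₁ , e₁ ⟩ → f ∋⟨ d₂ , e₂ ⟩ →
                 (C._<[_]_ d₁ X d₂ ⇔ D._<[_]_ e₁ Y e₂)

  record IsHHBisim (R : Subset C.n → Subset D.n → Rel C.n D.n → Set) : Set where
    field
      init : R ∅ ∅ emptyRel
      iso  : ∀ {X Y f} → R X Y f → Iso X Y f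
      fwdC : ∀ {X Y f a X'} → R X Y f → C.StepL X a X' →
             ∃[ Y' ] ∃[ f' ] (D.StepL Y a Y' × R X' Y' f' × restrict f' X ≡ f)
      fwdD : ∀ {X Y f a Y'} → R X Y f → D.StepL Y a Y' →
             ∃[ X' ] ∃[ f' ] (C.StepL X a X' × R X' Y' f' × restrict f' X ≡ f)
      revC : ∀ {X Y f a X'} → R X Y f → C.StepL X' a X →
             ∃[ Y' ] ∃[ f' ] (D.StepL Y' a Y × R X' Y' f' × restrict f X' ≡ f')
      revD : ∀ {X Y f a Y'} → R X Y f → D.StepL Y' a Y →
             ∃[ X' ] ∃[ f' ] (C.StepL X' a X × R X' Y' f' × restrict f X' ≡ f')

  HHBisimilar : Set₁
  HHBisimilar = ∃[ R ] IsHHBisim R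

  record State : Set where
    constructor ⟨_,_,_⟩
    field
      X : Subset C.n
      Y : Subset D.n
      f : Rel C.n D.n

  start : State
  start = ⟨ ∅ , ∅ , emptyRel ⟩

  data Dir : Set where
    fwd rev : Dir

  data AMove : Set where
    moveC : Dir → Fin C.n → Subset C.n → AMove
    moveD : Dir → Fin D.n → Subset D.n → AMove

  Reply : AMove → Set
  Reply (moveC _ _ _) = Fin D.n × Subset D.n
  Reply (moveD _ _ _) = Fin C.n × Subset C.n

  LegalA : State → AMove → Set
  LegalA ⟨ X , Y , f ⟩ (moveC fwd e X') = C.Step X e X'
  LegalA ⟨ X , Y , f ⟩ (moveC rev e X') = C.Step X' e X
  LegalA ⟨ X , Y , f ⟩ (moveD fwd e Y') = D.Step Y e Y'
  LegalA ⟨ X , Y , f ⟩ (moveD rev e Y') = D.Step Y' e Y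

  next : (s : State) (mv : AMove) → Reply mv → State
  next ⟨ X , Y , f ⟩ (moveC fwd e X') (e' , Y') = ⟨ X' , Y' , addPair f e e' ⟩
  next ⟨ X , Y , f ⟩ (moveC rev e X') (e' , Y') = ⟨ X' , Y' , restrict f X' ⟩
  next ⟨ X , Y , f ⟩ (moveD fwd e' Y') (e , X') = ⟨ X' , Y' , addPair f e e' ⟩
  next ⟨ X , Y , f ⟩ (moveD rev e' Y') (e , X') = ⟨ X' , Y' , restrict f X' ⟩

  LegalD : (s : State) (mv : AMove) → Reply mv → Set
  LegalD s@(⟨ X , Y , f ⟩) mv@(moveC fwd e X') r@(e' , Y') =
    D.Step Y e' Y' × C.ℓ e ≡ D.ℓ e' × Iso (State.X (next s mv r)) Y' (State.f (next s mv r))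
  LegalD s@(⟨ X , Y , f ⟩) mv@(moveC rev e X') r@(e' , Y') =
    D.Step Y' e' Y × C.ℓ e ≡ D.ℓ e' × Iso (State.X (next s mv r)) Y' (State.f (next s mv r))
  LegalD s@(⟨ X , Y , f ⟩) mv@(moveD fwd e' Y') r@(e , X') =
    C.Step X e X' × C.ℓ e ≡ D.ℓ e' × Iso X' (State.Y (next s mv r)) (State.f (next s mv r))
  LegalD s@(⟨ X , Y , f ⟩) mv@(moveD rev e' Y') r@(e , X') =
    C.Step X' e X × C.ℓ e ≡ D.ℓ e' × Iso X' (State.Y (next s mv r)) (State.f (next s mv r))

  Round : Set
  Round = Σ AMove Reply

  -- A strategy for the defender: given the play so far (the list of
  -- previous rounds, most recent first) and the attacker's current
  -- move, a reply.
  Strategy : Set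
  Strategy = List Round → (mv : AMove) → Reply mv

  open ListMem using () renaming (_∈_ to _∈ₗ_)

  -- Reach σ rs s vs : the play prefix rs, in which D follows σ and every
  -- move is legal, leads to the current state s; vs are the states
  -- visited before s (most recent first).  A play continues only while
  -- the current state has not been visited before.
  data Reach (σ : Strategy) : List Round → State → List State → Set where
    begin : Reach σ [] start []
    step  : ∀ {rs s vs} → Reach σ rs s vs → ¬ (s ∈ₗ vs) →
            (mv : AMove) → LegalA s mv → LegalD s mv (σ rs mv) →
            Reach σ ((mv , σ rs mv) ∷ rs) (next s mv (σ rs mv)) (s ∷ vs)

  -- σ is winning for D: in every play consistent with σ that has not yet
  -- ended (current state not previously visited), every legal attacker
  -- move is answered by σ with a legal reply.  (Plays are finite since
  -- there are finitely many states, so D never being stuck is the same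
  -- as D winning every play.)
  Winning : Strategy → Set
  Winning σ = ∀ rs s vs → Reach σ rs s vs → ¬ (s ∈ₗ vs) →
              ∀ (mv : AMove) → LegalA s mv → LegalD s mv (σ rs mv)

  DefenderWins : Set
  DefenderWins = ∃[ σ ] Winning σ

module Submission where

-- (⇒) Given an HH bisimulation R, the defender keeps the play inside R.
-- Her strategy replays the history, tracking the current state together
-- with evidence that R holds of it, and answers each legal attacker move
-- with the matching move provided by the bisimulation clause.  A forward
-- clause yields some isomorphism f' extending f; since f' is a bijection
-- and exactly one event is added on each side, f' is f ∪ {(e , e')}
-- ('extension-is-addPair'), which is the game's successor state.  A
-- strategy must also reply to illegal moves; any reply will do, but one
-- must exist: by stability every configuration is reachable from ∅
-- ('stable⇒reachable'), so R matches every event with an event of the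
-- other structure.
--
-- (⇐) Given a winning strategy σ, call a state fresh if some σ-play reaches
-- it without having visited it before.  Every state visited by a σ-play is
-- fresh (take its first visit), and σ answers every legal move from a fresh
-- state; so the fresh states form an HH bisimulation.

open import Defs
open import Function.Bundles using (_⇔_; mk⇔)
open import Data.Fin using (Fin; _≟_; zero; suc)
open import Data.Fin.Properties using (all?)
open import Data.Fin.Subset
  using (Subset; _∈_; _∉_; _∪_; ⁅_⁆; _-_; ∣_∣)
  renaming (⊥ to ∅)
open import Data.Fin.Subset.Properties
  using (_∈?_; _⊆?_; nonempty?; Empty-unique; ⊆-antisym; ∉⊥; x∈⁅x⁆; x∈⁅y⁆⇒x≡y;
         ∪-identityˡ; p─q⊆p; x∈p∧x≢y⇒x∈p-y; x∈p⇒∣p-x∣<∣p∣)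
open import Data.Nat using (_<_)
open import Data.Nat.Induction using (<-wellFounded)
open import Induction.WellFounded using (Acc; acc)
open import Data.Bool using (true; false; if_then_else_)
import Data.Bool as Bool
open import Data.Vec using (Vec; _∷_; there; lookup)
open import Data.Vec.Properties
  using (lookup∘updateAt; lookup∘updateAt′; lookup∘tabulate; tabulate∘lookup;
         tabulate-cong; []=⇒lookup; lookup⇒[]=; lookup-replicate; ≡-dec)
open import Data.Product using (Σ; ∃-syntax; _×_; _,_; proj₁)
open import Data.List using (List; []; _∷_)
open import Data.List.Relation.Unary.Any using (here; there)
open import Data.Maybe using (Maybe; just; nothing; maybe′)
import Data.Maybe as Maybe
open import Data.Empty using (⊥-elim)
open import Relation.Binary.PropositionalEquality
  using (_≡_; refl; sym; trans; cong; subst; module ≡-Reasoning)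
open import Relation.Nullary using (¬_; Dec; yes; no)
open import Relation.Nullary.Decidable using (_×-dec_; _→-dec_; ¬?; T?)
open import Relation.Binary.Definitions using (DecidableEquality)

vec-ext : ∀ {A : Set} {n} {u v : Vec A n} → (∀ i → lookup u i ≡ lookup v i) → u ≡ v
vec-ext {u = u} {v} same =
  trans (sym (tabulate∘lookup u)) (trans (tabulate-cong same) (tabulate∘lookup v))

only-member : ∀ {n} {p : Subset n} {y : Fin n} →
              y ∈ p → (∀ x → x ∈ p → x ≡ y) → p ≡ ⁅ y ⁆
only-member {y = y} y∈p only = ⊆-antisym
  (λ {x} x∈p → subst (_∈ ⁅ y ⁆) (sym (only x x∈p)) (x∈⁅x⁆ y))
  (λ {x} x∈⁅y⁆ → subst (_∈ _) (sym (x∈⁅y⁆⇒x≡y y x∈⁅y⁆)) y∈p)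

x∉p-x : ∀ {n} (x : Fin n) (p : Subset n) → x ∉ p - x
x∉p-x zero    (_ ∷ p) ()
x∉p-x (suc x) (_ ∷ p) (there x∈p-x) = x∉p-x x p x∈p-x

row-outside-dom : ∀ {n m} (f : Rel n m) {X : Subset n} {d : Fin n} →
                  (∀ d x → f ∋⟨ d , x ⟩ → d ∈ X) → d ∉ X → lookup f d ≡ ∅
row-outside-dom f dom d∉X = Empty-unique (λ (x , fdx) → d∉X (dom _ x fdx))

restrict-inside : ∀ {n m} (f : Rel n m) {X : Subset n} {d : Fin n} →
                  d ∈ X → lookup (restrict f X) d ≡ lookup f d
restrict-inside f {X} {d} d∈X
  rewrite lookup∘tabulate (λ d → if lookup X d then lookup f d else ∅) d
        | []=⇒lookup d∈X = refl

restrict-outside : ∀ {n m} (f : Rel n m) {X : Subset n} {d : Fin n} →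
                   d ∉ X → lookup (restrict f X) d ≡ ∅
restrict-outside f {X} {d} d∉X
  rewrite lookup∘tabulate (λ d → if lookup X d then lookup f d else ∅) d
  with lookup X d in X[d]
... | true  = ⊥-elim (d∉X (lookup⇒[]= d X X[d]))
... | false = refl

restrict-addPair : ∀ {n m} (f : Rel n m) (X : Subset n) (e : Fin n) (e' : Fin m) →
                   (∀ d x → f ∋⟨ d , x ⟩ → d ∈ X) → e ∉ X →
                   restrict (addPair f e e') X ≡ f
restrict-addPair f X e e' dom e∉X = vec-ext row
  where
  row : ∀ d → lookup (restrict (addPair f e e') X) d ≡ lookup f d
  row d with d ∈? X
  ... | yes d∈X = trans (restrict-inside (addPair f e e') d∈X)
                        (lookup∘updateAt′ d e (λ { refl → e∉X d∈X }) f)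
  ... | no  d∉X = trans (restrict-outside (addPair f e e') d∉X)
                        (sym (row-outside-dom f dom d∉X))

module _ {Act : Set} (𝒳 : ConfStr Act) where
  private module X = ConfStr 𝒳

  step? : ∀ X e X' → Dec (X.Step X e X')
  step? X e X' =
    T? _ ×-dec T? _ ×-dec X ⊆? X' ×-dec e ∈? X' ×-dec ¬? (e ∈? X) ×-dec
    all? (λ d → d ∈? X' →-dec ¬? (d ∈? X) →-dec d ≟ e)

  removal-step : ∀ X e → X.Conf X → e ∈ X → X.Conf (X - e) → X.Step (X - e) e X
  removal-step X e cX e∈X cX-e = cX-e , cX , p─q⊆p X ⁅ e ⁆ , e∈X , x∉p-x e X , only-e
    where
    only-e : ∀ d → d ∈ X → d ∉ X - e → d ≡ e
    only-e d d∈X d∉X-e with d ≟ e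
    ... | yes d≡e = d≡e
    ... | no  d≢e = ⊥-elim (d∉X-e (x∈p∧x≢y⇒x∈p-y d∈X d≢e))

  data Reachable : Subset X.n → Set where
    from-∅ : Reachable ∅
    extend : ∀ {X e X'} → Reachable X → X.Step X e X' → Reachable X'

  -- In a stable structure every configuration is reachable: by
  -- coincidence-freeness some event can be removed, and we recurse on size.
  stable⇒reachable : Stable 𝒳 → ∀ X → X.Conf X → Reachable X
  stable⇒reachable S X cX = go X (<-wellFounded ∣ X ∣) cX
    where
    go : ∀ X → Acc _<_ ∣ X ∣ → X.Conf X → Reachable X
    go X (acc smaller) cX with nonempty? X
    ... | no X-empty = subst Reachable (sym (Empty-unique X-empty)) from-∅
    ... | yes X-nonempty with Stable.coinit S X cX X-nonempty
    ...   | e , e∈X , cX-e =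
      extend (go (X - e) (smaller (x∈p⇒∣p-x∣<∣p∣ e∈X)) cX-e)
             (removal-step X e cX e∈X cX-e)

module _ {Act : Set} (𝒞 𝒟 : ConfStr Act) where
  private
    module C = ConfStr 𝒞
    module D = ConfStr 𝒟

  St : Set
  St = State 𝒞 𝒟

  Mv : Set
  Mv = AMove 𝒞 𝒟

  Holds : (Subset C.n → Subset D.n → Rel C.n D.n → Set) → St → Set
  Holds R s = R (State.X s) (State.Y s) (State.f s)

  IsoState : St → Set
  IsoState = Holds (Iso 𝒞 𝒟)

  iso-empty : Iso 𝒞 𝒟 ∅ ∅ emptyRel
  iso-empty = record
    { dom⊆  = λ d e h → ⊥-elim (unrelated d e h)
    ; cod⊆  = λ d e h → ⊥-elim (unrelated d e h)
    ; total = λ d h → ⊥-elim (∉⊥ h)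
    ; onto  = λ e h → ⊥-elim (∉⊥ h)
    ; func  = λ d e e' h _ → ⊥-elim (unrelated d e h)
    ; inj   = λ d d' e h _ → ⊥-elim (unrelated d e h)
    ; label = λ d e h → ⊥-elim (unrelated d e h)
    ; order = λ d₁ e₁ d₂ e₂ h _ → ⊥-elim (unrelated d₁ e₁ h)
    }
    where
    unrelated : ∀ d e → ¬ (emptyRel {C.n} {D.n} ∋⟨ d , e ⟩)
    unrelated d e h = ∉⊥ (subst (e ∈_) (lookup-replicate d ∅) h)

  extension-is-addPair : ∀ {X Y X' Y' f' e e'} →
    Iso 𝒞 𝒟 X Y (restrict f' X) → Iso 𝒞 𝒟 X' Y' f' →
    C.Step X e X' → D.Step Y e' Y' → f' ≡ addPair (restrict f' X) e e'
  extension-is-addPair {X} {Y} {X'} {Y'} {f'} {e} {e'} I I'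
    (_ , _ , _ , e∈X' , e∉X , only-e) (_ , _ , _ , _ , _ , only-e') = vec-ext row
    where
    module I = Iso I
    module I' = Iso I'
    f = restrict f' X

    -- the image of the new event is new, hence is e'
    image-of-e : ∀ x → f' ∋⟨ e , x ⟩ → x ≡ e'
    image-of-e x f'ex = only-e' x (I'.cod⊆ e x f'ex) x∉Y
      where
      x∉Y : x ∉ Y
      x∉Y x∈Y with I.onto x x∈Y
      ... | d , fdx = e∉X (subst (_∈ X) (I'.inj d e x f'dx f'ex) d∈X)
        where
        d∈X = I.dom⊆ d x fdx
        f'dx = subst (x ∈_) (restrict-inside f' d∈X) fdx

    row : ∀ d → lookup f' d ≡ lookup (addPair f e e') d
    row d with d ≟ e
    ... | yes refl = begin≡
      lookup f' e                 ≡⟨ only-member e'∈row image-of-e ⟩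
      ⁅ e' ⁆                      ≡⟨ sym (∪-identityˡ ⁅ e' ⁆) ⟩
      ∅ ∪ ⁅ e' ⁆                  ≡⟨ cong (_∪ ⁅ e' ⁆) (sym (restrict-outside f' e∉X)) ⟩
      lookup f e ∪ ⁅ e' ⁆         ≡⟨ sym (lookup∘updateAt e f) ⟩
      lookup (addPair f e e') e   ∎
      where
      -- renamed: 'begin' is also the constructor of the empty play in Defs
      open ≡-Reasoning renaming (begin_ to begin≡_)
      e'∈row : e' ∈ lookup f' e
      e'∈row with I'.total e e∈X'
      ... | x , f'ex = subst (_∈ lookup f' e) (image-of-e x f'ex) f'ex
    ... | no d≢e with d ∈? X
    ...   | yes d∈X = trans (sym (restrict-inside f' d∈X)) (sym (lookup∘updateAt′ d e d≢e f))
    ...   | no  d∉X = trans (row-outside-dom f' I'.dom⊆ (λ d∈X' → d≢e (only-e d d∈X' d∉X)))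
                            (sym (trans (lookup∘updateAt′ d e d≢e f) (restrict-outside f' d∉X)))

  legal? : (s : St) (mv : Mv) → Dec (LegalA 𝒞 𝒟 s mv)
  legal? ⟨ X , Y , f ⟩ (moveC fwd e X') = step? 𝒞 X e X'
  legal? ⟨ X , Y , f ⟩ (moveC rev e X') = step? 𝒞 X' e X
  legal? ⟨ X , Y , f ⟩ (moveD fwd e Y') = step? 𝒟 Y e Y'
  legal? ⟨ X , Y , f ⟩ (moveD rev e Y') = step? 𝒟 Y' e Y

  reply-iso : ∀ s mv r → LegalD 𝒞 𝒟 s mv r → IsoState (next 𝒞 𝒟 s mv r)
  reply-iso s (moveC fwd _ _) r (_ , _ , i) = i
  reply-iso s (moveC rev _ _) r (_ , _ , i) = i
  reply-iso s (moveD fwd _ _) r (_ , _ , i) = i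
  reply-iso s (moveD rev _ _) r (_ , _ , i) = i

  _≟S_ : DecidableEquality St
  ⟨ X , Y , f ⟩ ≟S ⟨ X' , Y' , f' ⟩
    with ≡-dec Bool._≟_ X X' | ≡-dec Bool._≟_ Y Y' | ≡-dec (≡-dec Bool._≟_) f f'
  ... | yes refl | yes refl | yes refl = yes refl
  ... | no X≢X'  | _        | _        = no λ { refl → X≢X' refl }
  ... | yes _    | no Y≢Y'  | _        = no λ { refl → Y≢Y' refl }
  ... | yes _    | yes _    | no f≢f'  = no λ { refl → f≢f' refl }

-- (⇒) An HH bisimulation yields a winning strategy for the defender.

module BisimulationToStrategy {Act : Set} (𝒞 𝒟 : ConfStr Act)
  (SC : Stable 𝒞) (SD : Stable 𝒟)
  (R : Subset (ConfStr.n 𝒞) → Subset (ConfStr.n 𝒟) → Rel (ConfStr.n 𝒞) (ConfStr.n 𝒟) → Set)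
  (H : IsHHBisim 𝒞 𝒟 R) where

  private
    module C = ConfStr 𝒞
    module D = ConfStr 𝒟
  open IsHHBisim H

  related-C : ∀ {X} → Reachable 𝒞 X → ∃[ Y ] ∃[ f ] R X Y f
  related-C from-∅ = ∅ , emptyRel , init
  related-C (extend {e = e} reach tr) with related-C reach
  ... | Y , f , p with fwdC p (e , refl , tr)
  ...   | Y' , f' , _ , p' , _ = Y' , f' , p'

  related-D : ∀ {Y} → Reachable 𝒟 Y → ∃[ X ] ∃[ f ] R X Y f
  related-D from-∅ = ∅ , emptyRel , init
  related-D (extend {e = e} reach tr) with related-D reach
  ... | X , f , p with fwdD p (e , refl , tr)
  ...   | X' , f' , _ , p' , _ = X' , f' , p'

  -- Every event has a partner in the other structure: it lies in a
  -- configuration, which is reachable by stability, hence related by R.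
  partner-C : Fin C.n → Fin D.n
  partner-C e with C.covers e
  ... | X , cX , e∈X with related-C (stable⇒reachable 𝒞 SC X cX)
  ...   | _ , _ , p = proj₁ (Iso.total (iso p) e e∈X)

  partner-D : Fin D.n → Fin C.n
  partner-D e with D.covers e
  ... | Y , cY , e∈Y with related-D (stable⇒reachable 𝒟 SD Y cY)
  ...   | _ , _ , p = proj₁ (Iso.onto (iso p) e e∈Y)

  -- The reply to an illegal move, which is never examined.
  default : (mv : Mv 𝒞 𝒟) → Reply 𝒞 𝒟 mv
  default (moveC _ e _) = partner-C e , ∅
  default (moveD _ e _) = partner-D e , ∅

  Position : Set
  Position = Σ (St 𝒞 𝒟) (Holds 𝒞 𝒟 R)

  Outcome : St 𝒞 𝒟 → Mv 𝒞 𝒟 → Set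
  Outcome s mv = Σ (Reply 𝒞 𝒟 mv) λ r → LegalD 𝒞 𝒟 s mv r × Holds 𝒞 𝒟 R (next 𝒞 𝒟 s mv r)

  respond : ((s , _) : Position) (mv : Mv 𝒞 𝒟) → LegalA 𝒞 𝒟 s mv → Outcome s mv
  respond (⟨ X , Y , f ⟩ , p) (moveC fwd e X') tr with fwdC p (e , refl , tr)
  ... | Y' , f' , (e' , ℓ≡ , trD) , p' , refl =
    (e' , Y') , (trD , sym ℓ≡ , subst (Iso 𝒞 𝒟 X' Y') f'≡ (iso p')) , subst (R X' Y') f'≡ p'
    where f'≡ = extension-is-addPair 𝒞 𝒟 (iso p) (iso p') tr trD
  respond (⟨ X , Y , f ⟩ , p) (moveC rev e X') tr with revC p (e , refl , tr)
  ... | Y' , _ , (e' , ℓ≡ , trD) , p' , refl =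
    (e' , Y') , (trD , sym ℓ≡ , iso p') , p'
  respond (⟨ X , Y , f ⟩ , p) (moveD fwd e' Y') tr with fwdD p (e' , refl , tr)
  ... | X' , f' , (e , ℓ≡ , trC) , p' , refl =
    (e , X') , (trC , ℓ≡ , subst (Iso 𝒞 𝒟 X' Y') f'≡ (iso p')) , subst (R X' Y') f'≡ p'
    where f'≡ = extension-is-addPair 𝒞 𝒟 (iso p) (iso p') trC tr
  respond (⟨ X , Y , f ⟩ , p) (moveD rev e' Y') tr with revD p (e' , refl , tr)
  ... | X' , _ , (e , ℓ≡ , trC) , p' , refl =
    (e , X') , (trC , ℓ≡ , iso p') , p'

  answer : ((s , _) : Position) (mv : Mv 𝒞 𝒟) → Maybe (Outcome s mv)
  answer (s , p) mv with legal? 𝒞 𝒟 s mv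
  ... | yes legal = just (respond (s , p) mv legal)
  ... | no  _     = nothing

  answer-legal : ∀ s p mv → LegalA 𝒞 𝒟 s mv → Σ (Outcome s mv) λ o → answer (s , p) mv ≡ just o
  answer-legal s p mv legal with legal? 𝒞 𝒟 s mv
  ... | yes _       = _ , refl
  ... | no  illegal = ⊥-elim (illegal legal)

  -- Replaying the history: the current position, as long as all moves were legal.
  track : List (Round 𝒞 𝒟) → Maybe Position
  track [] = just (start 𝒞 𝒟 , init)
  track ((mv , _) ∷ rs) with track rs
  ... | nothing      = nothing
  ... | just (s , p) = Maybe.map (λ (r , _ , q) → next 𝒞 𝒟 s mv r , q) (answer (s , p) mv)

  σ : Strategy 𝒞 𝒟
  σ rs mv with track rs
  ... | nothing      = default mv
  ... | just (s , p) = maybe′ proj₁ (default mv) (answer (s , p) mv)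

  tracks : ∀ {rs s vs} → Reach 𝒞 𝒟 σ rs s vs → Σ (Holds 𝒞 𝒟 R s) λ p → track rs ≡ just (s , p)
  tracks begin = init , refl
  tracks {(mv , _) ∷ rs} (step {s = s} reach _ mv legal _) with track rs | tracks reach
  ... | _ | p , refl with answer-legal s p mv legal
  ...   | (_ , _ , q) , answered rewrite answered = q , refl

  winning : Winning 𝒞 𝒟 σ
  winning rs s vs reach _ mv legal with track rs | tracks reach
  ... | _ | p , refl with answer-legal s p mv legal
  ...   | (_ , legalD , _) , answered rewrite answered = legalD

-- (⇐) A winning strategy yields an HH bisimulation.

module StrategyToBisimulation {Act : Set} (𝒞 𝒟 : ConfStr Act)
  (σ : Strategy 𝒞 𝒟) (win : Winning 𝒞 𝒟 σ) where

  private
    module C = ConfStr 𝒞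
    module D = ConfStr 𝒟
  open import Data.List.Membership.DecPropositional (_≟S_ 𝒞 𝒟)
    using () renaming (_∈?_ to _∈ₗ?_; _∈_ to _∈ₗ_)

  Fresh : St 𝒞 𝒟 → Set
  Fresh s = ∃[ rs ] ∃[ vs ] (Reach 𝒞 𝒟 σ rs s vs × ¬ (s ∈ₗ vs))

  -- Every state visited by a σ-play is fresh: consider its first visit.
  visited-fresh : ∀ {rs s vs} → Reach 𝒞 𝒟 σ rs s vs → ∀ t → t ∈ₗ (s ∷ vs) → Fresh t
  visited-fresh begin t (here refl) = [] , [] , begin , λ ()
  visited-fresh (step {s = s} {vs = vs} reach new mv legal legalD) t (here refl)
    with t ∈ₗ? (s ∷ vs)
  ... | yes earlier = visited-fresh reach t earlier
  ... | no  first   = _ , _ , step reach new mv legal legalD , first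
  visited-fresh (step reach _ _ _ _) t (there earlier) = visited-fresh reach t earlier

  fresh-iso : ∀ {s} → Fresh s → IsoState 𝒞 𝒟 s
  fresh-iso (_ , _ , begin , _) = iso-empty 𝒞 𝒟
  fresh-iso (_ , _ , step {s = s} _ _ mv _ legalD , _) = reply-iso 𝒞 𝒟 s mv _ legalD

  fresh-step : ∀ {s} → Fresh s → (mv : Mv 𝒞 𝒟) → LegalA 𝒞 𝒟 s mv →
               Σ (Reply 𝒞 𝒟 mv) λ r → LegalD 𝒞 𝒟 s mv r × Fresh (next 𝒞 𝒟 s mv r)
  fresh-step (rs , vs , reach , new) mv legal =
    σ rs mv , legalD , visited-fresh (step reach new mv legal legalD) _ (here refl)
    where legalD = win rs _ vs reach new mv legal

  R : Subset C.n → Subset D.n → Rel C.n D.n → Set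
  R X Y f = Fresh ⟨ X , Y , f ⟩

  isHHBisim : IsHHBisim 𝒞 𝒟 R
  isHHBisim = record
    { init = [] , [] , begin , λ ()
    ; iso  = fresh-iso
    ; fwdC = fwdC
    ; fwdD = fwdD
    ; revC = revC
    ; revD = revD
    }
    where
    fwdC : ∀ {X Y f a X'} → R X Y f → C.StepL X a X' →
           ∃[ Y' ] ∃[ f' ] (D.StepL Y a Y' × R X' Y' f' × restrict f' X ≡ f)
    fwdC {X} {f = f} {X' = X'} fresh (e , refl , tr@(_ , _ , _ , _ , e∉X , _))
      with fresh-step fresh (moveC fwd e X') tr
    ... | (e' , Y') , (trD , ℓ≡ , _) , fresh' =
      Y' , addPair f e e' , (e' , sym ℓ≡ , trD) , fresh' ,
      restrict-addPair f X e e' (Iso.dom⊆ (fresh-iso fresh)) e∉X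

    fwdD : ∀ {X Y f a Y'} → R X Y f → D.StepL Y a Y' →
           ∃[ X' ] ∃[ f' ] (C.StepL X a X' × R X' Y' f' × restrict f' X ≡ f)
    fwdD {X} {f = f} {Y' = Y'} fresh (e' , refl , tr)
      with fresh-step fresh (moveD fwd e' Y') tr
    ... | (e , X') , (trC@(_ , _ , _ , _ , e∉X , _) , ℓ≡ , _) , fresh' =
      X' , addPair f e e' , (e , ℓ≡ , trC) , fresh' ,
      restrict-addPair f X e e' (Iso.dom⊆ (fresh-iso fresh)) e∉X

    revC : ∀ {X Y f a X'} → R X Y f → C.StepL X' a X →
           ∃[ Y' ] ∃[ f' ] (D.StepL Y' a Y × R X' Y' f' × restrict f X' ≡ f')
    revC {f = f} {X' = X'} fresh (e , refl , tr)
      with fresh-step fresh (moveC rev e X') tr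
    ... | (e' , Y') , (trD , ℓ≡ , _) , fresh' =
      Y' , restrict f X' , (e' , sym ℓ≡ , trD) , fresh' , refl

    revD : ∀ {X Y f a Y'} → R X Y f → D.StepL Y' a Y →
           ∃[ X' ] ∃[ f' ] (C.StepL X' a X × R X' Y' f' × restrict f X' ≡ f')
    revD {f = f} {Y' = Y'} fresh (e' , refl , tr)
      with fresh-step fresh (moveD rev e' Y') tr
    ... | (e , X') , (trC , ℓ≡ , _) , fresh' =
      X' , restrict f X' , (e , ℓ≡ , trC) , fresh' , refl


proposition2 : ∀ {Act : Set} (𝒞 𝒟 : ConfStr Act) → Stable 𝒞 → Stable 𝒟 →
    (HHBisimilar 𝒞 𝒟 ⇔ DefenderWins 𝒞 𝒟)
proposition2 𝒞 𝒟 SC SD = mk⇔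
  (λ (R , H) → let open BisimulationToStrategy 𝒞 𝒟 SC SD R H in σ , winning)
  (λ (σ , win) → let open StrategyToBisimulation 𝒞 𝒟 σ win in R , isHHBisim)
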